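{- Let $\gamma$ be a set of frame conditions, $\Gamma$ a finite set of labelled formulae and $\varphi^x$ a labelled formula. The sequent $(\Gamma:\varphi^x)$ is valid (i.e. $\Gamma\Vdash^\gamma_{\mathcal{B}}\varphi^x$ for every base $\mathcal{B}$) if and only if $\Gamma\Vdash^{\gamma}_{\emptyset}\varphi^x$, where $\emptyset$ is the empty base.
   Context: Fix a countable set $\mathbb{W}$ of labels and a countable set $\mathbb{A}$ of propositional atoms. Modal formulae: $\varphi,\psi::= p\in\mathbb{A}\mid \varphi\wedge\psi\mid\varphi\vee\psi\mid\varphi\to\psi\mid\Box\varphi\mid\Diamond\varphi\mid\bot\mid\top$. A labelled formula is written $\varphi^x$ with $x\in\mathbb{W}$; a labelled atom is $p^x$ with $p\in\mathbb{A}$. A relational assumption is a pair of labels written $xRy$. A basic sentence is a labelled atom or a relational assumption; the labels of $p^x$ are $\{x\}$, of $xRy$ are $\{x,y\}$. A set of frame conditions is $\gamma\subseteq\{\gamma_D,\gamma_T,\gamma_B,\gamma_4,\gamma_5,\gamma_2\}$. A basic sequent $P\Rightarrow p$ consists of a finite set $P$ of basic sentences and a basic sentence $p$, which must be a labelled atom if $P\neq\emptyset$. A basic rule $(P_1\Rightarrow p_1,\dots,P_n\Rightarrow p_n)\Rightarrow r$ consists of finitely many basic sequents and a basic sentence $r$, which must be a labelled atom if $n\ge1$. A base is a set of basic rules. For a base $\mathcal{B}$ and finite set $S$ of basic sentences, $S\vdash^{\gamma}_{\mathcal{B}}p$ is defined inductively: (Ref) $S,p\vdash^\gamma_{\mathcal{B}}p$;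 (App) if $((P_1\Rightarrow p_1,\dots,P_n\Rightarrow p_n)\Rightarrow r)\in\mathcal{B}$ and $S,P_i\vdash^\gamma_{\mathcal{B}}p_i$ for each $i$, then $S\vdash^\gamma_{\mathcal{B}}r$; (D) if $\gamma_D\in\gamma$ and there is a label $y$, not a label of any element of $S$ and different from $x,z$, with $S,xRy\vdash^\gamma_{\mathcal{B}}p^z$, then $S\vdash^\gamma_{\mathcal{B}}p^z$; (T) if $\gamma_T\in\gamma$ and $S,xRx\vdash^\gamma_{\mathcal{B}}p^y$ then $S\vdash^\gamma_{\mathcal{B}}p^y$; (B) if $\gamma_B\in\gamma$, $S\vdash^\gamma_{\mathcal{B}}xRy$ and $S,yRx\vdash^\gamma_{\mathcal{B}}p^z$ then $S\vdash^\gamma_{\mathcal{B}}p^z$; (4) if $\gamma_4\in\gamma$, $S\vdash^\gamma_{\mathcal{B}}xRy$, $S\vdash^\gamma_{\mathcal{B}}yRz$ and $S,xRz\vdash^\gamma_{\mathcal{B}}p^w$ then $S\vdash^\gamma_{\mathcal{B}}p^w$; (5) if $\gamma_5\in\gamma$, $S\vdash^\gamma_{\mathcal{B}}xRy$, $S\vdash^\gamma_{\mathcal{B}}xRz$ and $S,yRz\vdash^\gamma_{\mathcal{B}}p^w$ then $S\vdash^\gamma_{\mathcal{B}}p^w$; (2) if $\gamma_2\in\gamma$, $S\vdash^\gamma_{\mathcal{B}}xRy$, $S\vdash^\gamma_{\mathcal{B}}xRz$ and there is a label $w$, not a label of any element of $S$ and different from $x,y,z,v$, with $S,yRw,zRw\vdash^\gamma_{\mathcal{B}}p^v$,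 then $S\vdash^\gamma_{\mathcal{B}}p^v$. Support. For a base $\mathcal{B}$: $\Vdash^\gamma_{\mathcal{B}}p^x$ iff $\vdash^\gamma_{\mathcal{B}}p^x$; $\Vdash^\gamma_{\mathcal{B}}xRy$ iff $\vdash^\gamma_{\mathcal{B}}xRy$; $\Vdash^\gamma_{\mathcal{B}}(\varphi\wedge\psi)^x$ iff $\Vdash^\gamma_{\mathcal{B}}\varphi^x$ and $\Vdash^\gamma_{\mathcal{B}}\psi^x$; $\Vdash^\gamma_{\mathcal{B}}(\varphi\vee\psi)^x$ iff for all bases $\mathcal{C}\supseteq\mathcal{B}$ and labelled atoms $p^z$, if $\varphi^x\Vdash^\gamma_{\mathcal{C}}p^z$ and $\psi^x\Vdash^\gamma_{\mathcal{C}}p^z$ then $\Vdash^\gamma_{\mathcal{C}}p^z$; $\Vdash^\gamma_{\mathcal{B}}(\varphi\to\psi)^x$ iff $\varphi^x\Vdash^\gamma_{\mathcal{B}}\psi^x$; $\Vdash^\gamma_{\mathcal{B}}(\Box\varphi)^x$ iff $xRy\Vdash^\gamma_{\mathcal{B}}\varphi^y$ for all labels $y$; $\Vdash^\gamma_{\mathcal{B}}(\Diamond\varphi)^x$ iff for all $\mathcal{C}\supseteq\mathcal{B}$ and labelled atoms $p^z$, if $xRy,\varphi^y\Vdash^\gamma_{\mathcal{C}}p^z$ for all labels $y$ then $\Vdash^\gamma_{\mathcal{C}}p^z$; $\Vdash^\gamma_{\mathcal{B}}\bot^x$ iff $\Vdash^\gamma_{\mathcal{B}}p^z$ for all labelled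 atoms $p^z$; $\Vdash^\gamma_{\mathcal{B}}\top^x$ always; and for a nonempty set $\Gamma$ of labelled formulae and relational assumptions, $\Gamma\Vdash^\gamma_{\mathcal{B}}\varphi$ iff for all $\mathcal{C}\supseteq\mathcal{B}$, if $\Vdash^\gamma_{\mathcal{C}}\psi$ for every $\psi\in\Gamma$ then $\Vdash^\gamma_{\mathcal{C}}\varphi$. -}

module Defs where

open import Level using (Level; 0ℓ; Lift) renaming (suc to lsuc)
open import Data.Nat using (ℕ)
open import Data.List using (List; []; _∷_; _++_; [_])
open import Data.List.Membership.Propositional using (_∈_)
open import Data.List.Relation.Unary.All using (All)
open import Data.Product using (_×_; _,_; Σ; ∃)
open import Data.Sum using (_⊎_)
open import Data.Empty using (⊥)
open import Data.Unit using (⊤)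
open import Relation.Nullary using (¬_)
open import Relation.Binary.PropositionalEquality using (_≡_; _≢_)

Label : Set
Label = ℕ

AtomName : Set
AtomName = ℕ

data Formula : Set where
  atom : AtomName → Formula
  _∧'_ _∨'_ _⇒'_ : Formula → Formula → Formula
  □ ◇ : Formula → Formula
  ⊥' ⊤' : Formula

data Basic : Set where
  at  : AtomName → Label → Basic
  rel : Label → Label → Basic

data LabelOf : Label → Basic → Set where
  lab-at   : ∀ {p x} → LabelOf x (at p x)
  lab-rel₁ : ∀ {x y} → LabelOf x (rel x y)
  lab-rel₂ : ∀ {x y} → LabelOf y (rel x y)

Fresh : Label → List Basic → Set
Fresh y S = All (λ s → ¬ LabelOf y s) S

data IsAtom : Basic → Set where
  isAtom : ∀ {p x} → IsAtom (at p x)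

record Sequent : Set where
  constructor _⇛_∣_
  field
    hyps  : List Basic
    concl : Basic
    wf    : hyps ≡ [] ⊎ IsAtom concl

record Rule : Set where
  constructor mkRule
  field
    prems : List Sequent
    concl : Basic
    wf    : prems ≡ [] ⊎ IsAtom concl

Base : Set₁
Base = Rule → Set

_⊆B_ : Base → Base → Set
B ⊆B C = ∀ r → B r → C r

emptyBase : Base
emptyBase = λ _ → ⊥

data FrameCond : Set where
  γD γT γB γ4 γ5 γ2 : FrameCond

FrameSet : Set₁
FrameSet = FrameCond → Set

-- Derivability S ⊢^γ_B p (finite sets of basic sentences as lists).
data Der (γ : FrameSet) (B : Base) : List Basic → Basic → Set where
  ref : ∀ {S p} → p ∈ S → Der γ B S p
  app : ∀ {S} (ρ : Rule) → B ρ →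
        (∀ σ → σ ∈ Rule.prems ρ → Der γ B (S ++ Sequent.hyps σ) (Sequent.concl σ)) →
        Der γ B S (Rule.concl ρ)
  ruleD : ∀ {S x y z p} → γ γD → Fresh y S → y ≢ x → y ≢ z →
          Der γ B (S ++ [ rel x y ]) (at p z) → Der γ B S (at p z)
  ruleT : ∀ {S x y p} → γ γT →
          Der γ B (S ++ [ rel x x ]) (at p y) → Der γ B S (at p y)
  ruleB : ∀ {S x y z p} → γ γB → Der γ B S (rel x y) →
          Der γ B (S ++ [ rel y x ]) (at p z) → Der γ B S (at p z)
  rule4 : ∀ {S x y z w p} → γ γ4 → Der γ B S (rel x y) → Der γ B S (rel y z) →
          Der γ B (S ++ [ rel x z ]) (at p w) → Der γ B S (at p w)
  rule5 : ∀ {S x y z w p} → γ γ5 → Der γ B S (rel x y) → Der γ B S (rel x z) →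
          Der γ B (S ++ [ rel y z ]) (at p w) → Der γ B S (at p w)
  rule2 : ∀ {S x y z w v p} → γ γ2 → Der γ B S (rel x y) → Der γ B S (rel x z) →
          Fresh w S → w ≢ x → w ≢ y → w ≢ z → w ≢ v →
          Der γ B (S ++ rel y w ∷ rel z w ∷ []) (at p v) → Der γ B S (at p v)

-- The consequence relations with nonempty left-hand
-- side occurring in the clauses (φ^x ⊩_C p^z, φ^x ⊩_B ψ^x, xRy ⊩_B φ^y,
-- xRy,φ^y ⊩_C p^z) are written out literally per the definition
-- "for all D ⊇ C, if D supports every hypothesis then D supports the conclusion".
Supp : FrameSet → Base → Formula → Label → Set₁
Supp γ B (atom p) x = Lift (lsuc 0ℓ) (Der γ B [] (at p x))
Supp γ B (φ ∧' ψ) x = Supp γ B φ x × Supp γ B ψ x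
Supp γ B (φ ∨' ψ) x =
  ∀ (C : Base) → B ⊆B C → ∀ p z →
    (∀ D → C ⊆B D → Supp γ D φ x → Der γ D [] (at p z)) →
    (∀ D → C ⊆B D → Supp γ D ψ x → Der γ D [] (at p z)) →
    Der γ C [] (at p z)
Supp γ B (φ ⇒' ψ) x = ∀ (C : Base) → B ⊆B C → Supp γ C φ x → Supp γ C ψ x
Supp γ B (□ φ) x =
  ∀ (y : Label) (C : Base) → B ⊆B C → Der γ C [] (rel x y) → Supp γ C φ y
Supp γ B (◇ φ) x =
  ∀ (C : Base) → B ⊆B C → ∀ p z →
    (∀ y D → C ⊆B D → Der γ D [] (rel x y) → Supp γ D φ y → Der γ D [] (at p z)) →
    Der γ C [] (at p z)
Supp γ B ⊥' x = Lift (lsuc 0ℓ) (∀ p z → Der γ B [] (at p z))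
Supp γ B ⊤' x = Lift (lsuc 0ℓ) ⊤

LFormula : Set
LFormula = Formula × Label

SuppCtx : FrameSet → Base → List LFormula → LFormula → Set₁
SuppCtx γ B [] (φ , x) = Supp γ B φ x
SuppCtx γ B Γ@(_ ∷ _) (φ , x) =
  ∀ (C : Base) → B ⊆B C → All (λ { (ψ , y) → Supp γ C ψ y }) Γ → Supp γ C φ x

Valid : FrameSet → List LFormula → LFormula → Set₁
Valid γ Γ φx = ∀ (B : Base) → SuppCtx γ B Γ φx

-- Support is monotone along base extension: derivability is, since every rule
-- of a smaller base is a rule of a larger one, and each compound clause of the
-- support relation already quantifies over all extensions.  The empty base is
-- contained in every base, so support in it transfers to all bases.
module Submission where

open import Defs
open import Data.List using (List; []; _∷_)
open import Data.Product using (_,_)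
open import Function.Bundles using (_⇔_; mk⇔)
open import Level using (lift; lower)

⊆B-trans : ∀ {A B C : Base} → A ⊆B B → B ⊆B C → A ⊆B C
⊆B-trans A⊆B B⊆C r r∈A = B⊆C r (A⊆B r r∈A)

emptyBase-⊆B : ∀ {B : Base} → emptyBase ⊆B B
emptyBase-⊆B r ()

Der-mono : ∀ {γ B C S p} → B ⊆B C → Der γ B S p → Der γ C S p
Der-mono B⊆C (ref p∈S) = ref p∈S
Der-mono B⊆C (app ρ ρ∈B ds) = app ρ (B⊆C ρ ρ∈B) (λ σ σ∈ → Der-mono B⊆C (ds σ σ∈))
Der-mono B⊆C (ruleD g fresh y≢x y≢z d) = ruleD g fresh y≢x y≢z (Der-mono B⊆C d)
Der-mono B⊆C (ruleT g d) = ruleT g (Der-mono B⊆C d)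
Der-mono B⊆C (ruleB g xy d) = ruleB g (Der-mono B⊆C xy) (Der-mono B⊆C d)
Der-mono B⊆C (rule4 g xy yz d) =
  rule4 g (Der-mono B⊆C xy) (Der-mono B⊆C yz) (Der-mono B⊆C d)
Der-mono B⊆C (rule5 g xy xz d) =
  rule5 g (Der-mono B⊆C xy) (Der-mono B⊆C xz) (Der-mono B⊆C d)
Der-mono B⊆C (rule2 g xy xz fresh w≢x w≢y w≢z w≢v d) =
  rule2 g (Der-mono B⊆C xy) (Der-mono B⊆C xz) fresh w≢x w≢y w≢z w≢v (Der-mono B⊆C d)

Supp-mono : ∀ {γ B C} φ x → B ⊆B C → Supp γ B φ x → Supp γ C φ x
Supp-mono (atom p) x B⊆C s = lift (Der-mono B⊆C (lower s))
Supp-mono (φ ∧' ψ) x B⊆C (sφ , sψ) = Supp-mono φ x B⊆C sφ , Supp-mono ψ x B⊆C sψ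
Supp-mono (φ ∨' ψ) x B⊆C s D C⊆D = s D (⊆B-trans B⊆C C⊆D)
Supp-mono (φ ⇒' ψ) x B⊆C s D C⊆D = s D (⊆B-trans B⊆C C⊆D)
Supp-mono (□ φ) x B⊆C s y D C⊆D = s y D (⊆B-trans B⊆C C⊆D)
Supp-mono (◇ φ) x B⊆C s D C⊆D = s D (⊆B-trans B⊆C C⊆D)
Supp-mono ⊥' x B⊆C s = lift (λ p z → Der-mono B⊆C (lower s p z))
Supp-mono ⊤' x B⊆C s = s

SuppCtx-mono : ∀ {γ B C} Γ φx → B ⊆B C → SuppCtx γ B Γ φx → SuppCtx γ C Γ φx
SuppCtx-mono [] (φ , x) B⊆C s = Supp-mono φ x B⊆C s
SuppCtx-mono (_ ∷ _) (φ , x) B⊆C s D C⊆D = s D (⊆B-trans B⊆C C⊆D)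

lemma4 : (γ : FrameSet) (Γ : List LFormula) (φx : LFormula) →
         Valid γ Γ φx ⇔ SuppCtx γ emptyBase Γ φx
lemma4 γ Γ φx =
  mk⇔ (λ valid → valid emptyBase)
      (λ s B → SuppCtx-mono Γ φx emptyBase-⊆B s)
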